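{- There exists an absolute constant $C>0$ such that the following holds. Let $A$ be a finite set with $|A|=m$, and let $\mathcal S\subseteq 2^A$. If the set-system incidence graph $G(A,\mathcal S)$ is an $\ell$-interval-PCG (for a positive integer $\ell$), then $|\mathcal S|\le C m^3\ell^2$.
   Context: All graphs are finite, simple and undirected. For a finite set $A$ and $\mathcal S\subseteq 2^A$, the set-system incidence graph $G(A,\mathcal S)$ is the bipartite graph with vertex set $A\cup B$, $B=\{b_S:S\in\mathcal S\}$ (new distinct vertices), where $a b_S$ is an edge iff $a\in S$. For an edge-weighted tree $T$ (nonnegative real edge weights) and leaves $x,y$, $d_T(x,y)$ is the sum of the weights on the unique $x$–$y$ path; $L(T)$ is the leaf set. For a positive integer $\ell$, $G=(V,E)$ is an $\ell$-interval-PCG if there exist an edge-weighted tree $T$, intervals $I_1,\dots,I_\ell$ of nonnegative reals and a bijection $\zeta:V\to L(T)$ such that for all distinct $u,v\in V$: $uv\in E\iff d_T(\zeta(u),\zeta(v))\in\bigcup_{i=1}^\ell I_i$.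
   Formalization: In the ℓ-interval-PCG hypothesis, the tree's edge weights are rational and the intervals $I_1,\dots,I_\ell$ are intervals of nonnegative rationals rather than of nonnegative reals. -}

module Defs where

open import Level using (Level)
open import Data.Nat using (ℕ; _≤_)
open import Data.Fin using (Fin)
open import Data.Fin.Subset using (Subset; _∈_)
open import Data.Sum using (_⊎_; inj₁; inj₂)
open import Data.Product using (Σ; _×_)
open import Data.Empty using (⊥)
open import Data.List using (List; []; _∷_)
open import Data.List.Relation.Unary.Unique.Propositional using (Unique)
open import Data.Rational using (ℚ; 0ℚ; _+_) renaming (_≤_ to _≤ℚ_)
open import Relation.Nullary using (¬_)
open import Relation.Binary.PropositionalEquality using (_≡_; _≢_)
open import Function.Bundles using (_⇔_)

data Walk {V : Set} (Adj : V → V → Set) : V → V → Set where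
  []  : ∀ {x} → Walk Adj x x
  _∷_ : ∀ {x y z} → Adj x y → Walk Adj y z → Walk Adj x z

len : ∀ {V : Set} {Adj : V → V → Set} {x y} → Walk Adj x y → ℕ
len []      = 0
len (_ ∷ p) = Data.Nat.suc (len p)

verts : ∀ {V : Set} {Adj : V → V → Set} {x y} → Walk Adj x y → List V
verts {x = x} []      = x ∷ []
verts {x = x} (_ ∷ p) = x ∷ verts p

dropFirst : ∀ {V : Set} → List V → List V
dropFirst []       = []
dropFirst (_ ∷ xs) = xs

weight : ∀ {V : Set} {Adj : V → V → Set} (w : V → V → ℚ) {x y} → Walk Adj x y → ℚ
weight w []                    = 0ℚ
weight w (_∷_ {x} {y} _ p) = w x y + weight w p

IsPath : ∀ {V : Set} {Adj : V → V → Set} {x y} → Walk Adj x y → Set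
IsPath p = Unique (verts p)

IsCycle : ∀ {V : Set} {Adj : V → V → Set} {x} → Walk Adj x x → Set
IsCycle p = 3 ≤ len p × Unique (dropFirst (verts p))

record WTree (t : ℕ) : Set₁ where
  field
    Adj       : Fin t → Fin t → Set
    adj-sym   : ∀ {x y} → Adj x y → Adj y x
    adj-irr   : ∀ {x} → ¬ Adj x x
    w         : Fin t → Fin t → ℚ
    w-sym     : ∀ x y → w x y ≡ w y x
    w-nonneg  : ∀ x y → Adj x y → 0ℚ ≤ℚ w x y
    connected : ∀ x y → Walk Adj x y
    acyclic   : ∀ x (c : Walk Adj x x) → ¬ IsCycle c

IsLeaf : ∀ {t} → WTree t → Fin t → Set
IsLeaf T x = Σ _ λ y → Adj x y × (∀ z → Adj x z → z ≡ y)
  where open WTree T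

-- Intervals of nonnegative reals, restricted to the rationals:
-- nonnegative convex subsets of ℚ.

record Interval : Set₁ where
  field
    mem    : ℚ → Set
    nonneg : ∀ q → mem q → 0ℚ ≤ℚ q
    convex : ∀ a b c → mem a → mem c → a ≤ℚ b → b ≤ℚ c → mem b

record IntervalPCG (ℓ : ℕ) {V : Set} (E : V → V → Set) : Set₁ where
  field
    t      : ℕ
    T      : WTree t
    I      : Fin ℓ → Interval
    ζ      : V → Fin t
    ζ-leaf : ∀ v → IsLeaf T (ζ v)
    ζ-inj  : ∀ u v → ζ u ≡ ζ v → u ≡ v
    ζ-surj : ∀ x → IsLeaf T x → Σ V λ v → ζ v ≡ x
    -- d_T(ζ u, ζ v) is the weight of the unique ζ u – ζ v path in T
    edges  : ∀ u v → u ≢ v →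
             E u v ⇔ Σ (Walk (WTree.Adj T) (ζ u) (ζ v)) λ p →
                       IsPath p × Σ (Fin ℓ) λ i → Interval.mem (I i) (weight (WTree.w T) p)

-- Set-system incidence graph G(A, 𝒮) with A = Fin m and
-- 𝒮 = {S j : j ∈ Fin k} (S injective, so |𝒮| = k).
-- Vertices: inj₁ a for a ∈ A, inj₂ j for b_{S j}.

IncEdge : ∀ {m k} → (Fin k → Subset m) → Fin m ⊎ Fin k → Fin m ⊎ Fin k → Set
IncEdge S (inj₁ a) (inj₂ j) = a ∈ S j
IncEdge S (inj₂ j) (inj₁ a) = a ∈ S j
IncEdge S (inj₁ _) (inj₁ _) = ⊥
IncEdge S (inj₂ _) (inj₂ _) = ⊥

module Submission where

-- Root the tree at an element leaf, let δ be the weighted depth and x ∧ y the meet in the ancestor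
-- order; the tree distance is then δ x + δ y − 2 δ (x ∧ y). For a set vertex b let junction b be its
-- deepest ancestor with an element leaf below it, and D the set of element leaves below it. For a ∈ D
-- the distance from b to a is (δ b − 2 δ (junction b)) + δ a; for a ∉ D it is δ b + c(a), where c
-- depends on b only through D. The sets D form a laminar family on m points, and are named injectively
-- by 2m keys. Within one key class the distance from b to a fixed a is therefore monotone in one of two
-- rational parameters of b, and so is its position (before, inside, after: 0, 1, 2) relative to each
-- convex interval I i. Two sums of positions, over a ∈ D and over a ∉ D, each at most 2mℓ, then
-- determine every position and hence S b; so b ↦ (key, sum, sum) is injective and
-- k ≤ 2m(2mℓ + 1)² ≤ 18 m³ℓ². For m = 0 injectivity leaves at most one set vertex, and a graph with
-- a single vertex is no PCG because no tree has exactly one leaf.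

open import Defs
open import Level using (0ℓ)
open import Algebra.Core using (Op₂)
open import Data.Bool using (true; false; if_then_else_)
open import Data.Nat using (ℕ; zero; suc; _≤_; _<_; _*_; _^_; _≤?_; z≤n; s≤s)
import Data.Nat as ℕ
import Data.Nat.Properties as ℕ
open import Data.Nat.Solver using (module +-*-Solver)
open import Data.Fin using (Fin; zero; suc; _≟_) renaming (_≤_ to _≤ᶠ_)
import Data.Fin.Properties as Fin
open import Data.Fin.Subset using (Subset; _⊆_) renaming (_∈_ to _∈ˢ_)
open import Data.Fin.Subset.Properties using (⊆-antisym)
open import Data.Vec using ([])
open import Data.Product using (Σ; _×_; _,_; ∃; proj₁; proj₂)
open import Data.Sum using (_⊎_; inj₁; inj₂; [_,_]′)
import Data.Sum as Sum
open import Data.Empty using (⊥; ⊥-elim)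
open import Data.Unit using (⊤; tt)
open import Data.List using (List; []; _∷_; _++_; [_]; reverse; length)
open import Data.List.Properties
  using (∷-injectiveˡ; ∷-injectiveʳ; ∷ʳ-injectiveˡ; unfold-reverse; ++-assoc; ++-identityʳ; length-++)
open import Data.List.Relation.Unary.All using (All; []; _∷_)
import Data.List.Relation.Unary.All as All
import Data.List.Relation.Unary.All.Properties as All
open import Data.List.Relation.Unary.Any using (here; there)
import Data.List.Relation.Unary.Any.Properties as Any
open import Data.List.Relation.Unary.AllPairs using ([]; _∷_)
import Data.List.Relation.Unary.AllPairs as AllPairs
open import Data.List.Relation.Unary.Unique.Propositional using (Unique)
import Data.List.Relation.Unary.Unique.Propositional.Properties as Unique
open import Data.List.Relation.Binary.Disjoint.Propositional using (Disjoint)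
import Data.List.Relation.Binary.Permutation.Setoid as Permutation
import Data.List.Relation.Binary.Permutation.Setoid.Properties as PermutationProperties
open import Data.List.Membership.Propositional using (_∈_; _∉_)
open import Data.List.Membership.Propositional.Properties using (∈-++⁺ˡ; ∈-++⁺ʳ; ∈-++⁻)
import Data.List.Membership.DecPropositional as DecMembership
open import Data.Rational using (ℚ; 0ℚ)
import Data.Rational.Properties as ℚ
open import Data.Rational.Solver renaming (module +-*-Solver to ℚ-Solver)
open import Function using (_∘_; id; flip; Injective)
open import Function.Bundles using (_⇔_; mk⇔; Equivalence)
open import Relation.Nullary using (¬_; yes; no; does; contradiction)
open import Relation.Nullary.Negation using (¬¬-map)
open import Relation.Nullary.Decidable using (_×-dec_; decidable-stable)
open import Relation.Unary using (Pred) renaming (Decidable to Decidable₁)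
open import Relation.Binary using (Rel; Reflexive; Transitive; Decidable)
open import Relation.Binary.Lattice using (IsMeetSemilattice)
open import Relation.Binary.PropositionalEquality
  using (_≡_; _≢_; refl; sym; trans; cong; cong₂; subst; subst₂; setoid; isEquivalence; module ≡-Reasoning)

Unique-++⁻ : ∀ {A : Set} (xs : List A) {ys} → Unique (xs ++ ys) → Unique xs × Unique ys
Unique-++⁻ []       u          = [] , u
Unique-++⁻ (x ∷ xs) (x∉ ∷ u) = All.++⁻ˡ xs x∉ ∷ proj₁ (Unique-++⁻ xs u) , proj₂ (Unique-++⁻ xs u)

++-≡-++⇒suffix : ∀ {A : Set} (as bs : List A) {xs ys} → as ++ xs ≡ bs ++ ys →
                 (∃ λ cs → xs ≡ cs ++ ys) ⊎ (∃ λ cs → ys ≡ cs ++ xs)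
++-≡-++⇒suffix []       bs       eq = inj₁ (bs , eq)
++-≡-++⇒suffix (a ∷ as) []       eq = inj₂ (a ∷ as , sym eq)
++-≡-++⇒suffix (a ∷ as) (b ∷ bs) eq = ++-≡-++⇒suffix as bs (∷-injectiveʳ eq)

module Walks {V : Set} {Adj : V → V → Set} where

  open import Data.Rational using (_+_)

  private
    W : V → V → Set
    W = Walk Adj

  infixr 5 _++ᵂ_

  _++ᵂ_ : ∀ {x y z} → W x y → W y z → W x z
  []      ++ᵂ q = q
  (e ∷ p) ++ᵂ q = e ∷ (p ++ᵂ q)

  initVerts : ∀ {x y} → W x y → List V
  initVerts []          = []
  initVerts {x} (_ ∷ p) = x ∷ initVerts p

  verts-start : ∀ {x y} (p : W x y) → verts p ≡ x ∷ dropFirst (verts p)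
  verts-start []      = refl
  verts-start (_ ∷ _) = refl

  start-unique : ∀ {x x′ y y′} (p : W x y) (q : W x′ y′) → verts p ≡ verts q → x ≡ x′
  start-unique p q eq = ∷-injectiveˡ (trans (sym (verts-start p)) (trans eq (verts-start q)))

  start∈verts : ∀ {x y} (p : W x y) → x ∈ verts p
  start∈verts p = subst (_ ∈_) (sym (verts-start p)) (here refl)

  end∈verts : ∀ {x y} (p : W x y) → y ∈ verts p
  end∈verts []      = here refl
  end∈verts (_ ∷ p) = there (end∈verts p)

  verts-initVerts : ∀ {x y} (p : W x y) → verts p ≡ initVerts p ++ [ y ]
  verts-initVerts []      = refl
  verts-initVerts (_ ∷ p) = cong (_ ∷_) (verts-initVerts p)

  verts-++ᵂ : ∀ {x y z} (p : W x y) (q : W y z) → verts (p ++ᵂ q) ≡ initVerts p ++ verts q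
  verts-++ᵂ []      q = refl
  verts-++ᵂ (_ ∷ p) q = cong (_ ∷_) (verts-++ᵂ p q)

  verts-++ᵂ-dropFirst : ∀ {x y z} (p : W x y) (q : W y z) → verts (p ++ᵂ q) ≡ verts p ++ dropFirst (verts q)
  verts-++ᵂ-dropFirst []      q = verts-start q
  verts-++ᵂ-dropFirst (_ ∷ p) q = cong (_ ∷_) (verts-++ᵂ-dropFirst p q)

  first-step : ∀ {x y} → W x y → x ≢ y → ∃ (Adj x)
  first-step []      x≢x = ⊥-elim (x≢x refl)
  first-step (e ∷ _) _   = _ , e

  IsPath-++ᵂ⁺ : ∀ {x y z} (p : W x y) (q : W y z) → IsPath p → IsPath q →
                Disjoint (initVerts p) (verts q) → IsPath (p ++ᵂ q)
  IsPath-++ᵂ⁺ p q p-path q-path disjoint = subst Unique (sym (verts-++ᵂ p q))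
    (Unique.++⁺ (proj₁ (Unique-++⁻ (initVerts p) (subst Unique (verts-initVerts p) p-path))) q-path disjoint)

  IsPath-++ᵂ⁻ : ∀ {x y z} (p : W x y) (q : W y z) → IsPath (p ++ᵂ q) → IsPath p × IsPath q
  IsPath-++ᵂ⁻ p q path =
    proj₁ (Unique-++⁻ (verts p) (subst Unique (verts-++ᵂ-dropFirst p q) path)) ,
    proj₂ (Unique-++⁻ (initVerts p) (subst Unique (verts-++ᵂ p q) path))

  splitAt : ∀ {x y z} (p : W x y) → z ∈ verts p → ∃ λ (α : W x z) → ∃ λ (β : W z y) → p ≡ α ++ᵂ β
  splitAt []      (here refl) = [] , [] , refl
  splitAt (e ∷ p) (here refl) = [] , e ∷ p , refl
  splitAt (e ∷ p) (there z∈)  with splitAt p z∈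
  ... | α , β , refl = e ∷ α , β , refl

  splitAtFirst : ∀ {Q : Pred V 0ℓ} → Decidable₁ Q → ∀ {x y} (p : W x y) → Q y →
                 ∃ λ z → Q z × ∃ λ (α : W x z) → All (λ v → ¬ Q v) (initVerts α) ×
                                  ∃ λ (β : W z y) → p ≡ α ++ᵂ β
  splitAtFirst Q? []          qy = _ , qy , [] , [] , [] , refl
  splitAtFirst Q? {x} (e ∷ p) qy with Q? x | splitAtFirst Q? p qy
  ... | yes qx | _                            = x , qx , [] , [] , e ∷ p , refl
  ... | no ¬qx | z , qz , α , ¬Qα , β , refl = z , qz , e ∷ α , ¬qx ∷ ¬Qα , β , refl

  module _ (w : V → V → ℚ) where

    weight-++ᵂ : ∀ {x y z} (p : W x y) (q : W y z) → weight w (p ++ᵂ q) ≡ weight w p + weight w q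
    weight-++ᵂ []                q = sym (ℚ.+-identityˡ _)
    weight-++ᵂ (_∷_ {x} {u} e p) q = trans (cong (w x u +_) (weight-++ᵂ p q)) (sym (ℚ.+-assoc (w x u) _ _))

    vertsWeight : List V → ℚ
    vertsWeight (a ∷ b ∷ xs) = w a b + vertsWeight (b ∷ xs)
    vertsWeight _            = 0ℚ

    weight≡vertsWeight : ∀ {x y} (p : W x y) → weight w p ≡ vertsWeight (verts p)
    weight≡vertsWeight []                      = refl
    weight≡vertsWeight (e ∷ [])                = refl
    weight≡vertsWeight (_∷_ {x} {u} e (f ∷ p)) = cong (w x u +_) (weight≡vertsWeight (f ∷ p))

    weight-cong : ∀ {x y x′ y′} (p : W x y) (q : W x′ y′) → verts p ≡ verts q → weight w p ≡ weight w q
    weight-cong p q eq = trans (weight≡vertsWeight p) (trans (cong vertsWeight eq) (sym (weight≡vertsWeight q)))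

module Trees {t : ℕ} (T : WTree t) where

  open WTree T
  open Walks {Fin t} {Adj}
  open DecMembership (_≟_ {t}) using (_∈?_)
  open Permutation (setoid (Fin t)) using (↭-sym)
  open PermutationProperties (setoid (Fin t)) using (Unique-resp-↭; ↭-reverse)
  open import Data.Rational using (_+_)

  private
    W : Fin t → Fin t → Set
    W = Walk Adj

  infixr 5 _ʳ++ᵂ_

  _ʳ++ᵂ_ : ∀ {s x y} → W s x → W s y → W x y
  []      ʳ++ᵂ p = p
  (e ∷ q) ʳ++ᵂ p = q ʳ++ᵂ (adj-sym e ∷ p)

  reverseᵂ : ∀ {x y} → W x y → W y x
  reverseᵂ q = q ʳ++ᵂ []

  verts-ʳ++ᵂ : ∀ {s x y} (q : W s x) (p : W s y) → verts (q ʳ++ᵂ p) ≡ reverse (verts q) ++ dropFirst (verts p)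
  verts-ʳ++ᵂ []          p = verts-start p
  verts-ʳ++ᵂ {s} (e ∷ q) p = begin
    verts (q ʳ++ᵂ (adj-sym e ∷ p))                      ≡⟨ verts-ʳ++ᵂ q (adj-sym e ∷ p) ⟩
    reverse (verts q) ++ verts p                        ≡⟨ cong (reverse (verts q) ++_) (verts-start p) ⟩
    reverse (verts q) ++ s ∷ dropFirst (verts p)        ≡⟨ ++-assoc (reverse (verts q)) [ s ] _ ⟨
    (reverse (verts q) ++ [ s ]) ++ dropFirst (verts p) ≡⟨ cong (_++ dropFirst (verts p)) (unfold-reverse s (verts q)) ⟨
    reverse (s ∷ verts q) ++ dropFirst (verts p)        ∎
    where open ≡-Reasoning

  verts-reverseᵂ : ∀ {x y} (q : W x y) → verts (reverseᵂ q) ≡ reverse (verts q)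
  verts-reverseᵂ q = trans (verts-ʳ++ᵂ q []) (++-identityʳ _)

  IsPath-reverseᵂ : ∀ {x y} (q : W x y) → IsPath q → IsPath (reverseᵂ q)
  IsPath-reverseᵂ q path = subst Unique (sym (verts-reverseᵂ q)) (Unique-resp-↭ (↭-sym (↭-reverse (verts q))) path)

  weight-ʳ++ᵂ : ∀ {s x y} (q : W s x) (p : W s y) → weight w (q ʳ++ᵂ p) ≡ weight w q + weight w p
  weight-ʳ++ᵂ []                p = sym (ℚ.+-identityˡ _)
  weight-ʳ++ᵂ (_∷_ {s} {u} e q) p = begin
    weight w (q ʳ++ᵂ (adj-sym e ∷ p)) ≡⟨ weight-ʳ++ᵂ q (adj-sym e ∷ p) ⟩
    weight w q + (w u s + weight w p) ≡⟨ cong (λ a → weight w q + (a + weight w p)) (w-sym u s) ⟩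
    weight w q + (w s u + weight w p) ≡⟨ regroup (w s u) (weight w q) (weight w p) ⟩
    (w s u + weight w q) + weight w p ∎
    where
      open ≡-Reasoning
      open ℚ-Solver
      regroup : ∀ a b c → b + (a + c) ≡ (a + b) + c
      regroup = solve 3 (λ a b c → b :+ (a :+ c) := (a :+ b) :+ c) refl

  weight-reverseᵂ : ∀ {x y} (q : W x y) → weight w (reverseᵂ q) ≡ weight w q
  weight-reverseᵂ q = trans (weight-ʳ++ᵂ q []) (ℚ.+-identityʳ _)

  len-ʳ++ᵂ : ∀ {s x y} (q : W s x) (p : W s y) → len (q ʳ++ᵂ p) ≡ len q ℕ.+ len p
  len-ʳ++ᵂ []      p = refl
  len-ʳ++ᵂ (e ∷ q) p = trans (len-ʳ++ᵂ q (adj-sym e ∷ p)) (ℕ.+-suc (len q) (len p))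

  NonBacktracking : ∀ {x y} → W x y → Set
  NonBacktracking (_∷_ {x} _ (_∷_ {y = z} f p)) = x ≢ z × NonBacktracking (f ∷ p)
  NonBacktracking _                               = ⊤

  NonBacktracking-tail : ∀ {x u y} (e : Adj x u) (p : W u y) → NonBacktracking (e ∷ p) → NonBacktracking p
  NonBacktracking-tail e []      _        = tt
  NonBacktracking-tail e (_ ∷ _) (_ , nb) = nb

  IsPath⇒NonBacktracking : ∀ {x y} (p : W x y) → IsPath p → NonBacktracking p
  IsPath⇒NonBacktracking []          _                 = tt
  IsPath⇒NonBacktracking (e ∷ [])    _                 = tt
  IsPath⇒NonBacktracking (e ∷ f ∷ p) ((_ ∷ x∉) ∷ path) =
    All.lookup x∉ (start∈verts p) , IsPath⇒NonBacktracking (f ∷ p) path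

  private
    no-return : ∀ {x u y} (e : Adj x u) (α : W u x) (β : W x y) →
                NonBacktracking (e ∷ α ++ᵂ β) → IsPath α → ⊥
    no-return e []          β _         _    = adj-irr e
    no-return e (f ∷ [])    β (x≢x , _) _    = x≢x refl
    no-return e (f ∷ g ∷ α) β _         path = acyclic _ (e ∷ f ∷ g ∷ α) (s≤s (s≤s (s≤s z≤n)) , path)

  NonBacktracking⇒IsPath : ∀ {x y} (p : W x y) → NonBacktracking p → IsPath p
  NonBacktracking⇒IsPath []      _  = [] ∷ []
  NonBacktracking⇒IsPath (e ∷ p) nb = All.¬Any⇒All¬ _ x∉p ∷ path
    where
      path : IsPath p
      path = NonBacktracking⇒IsPath p (NonBacktracking-tail e p nb)
      x∉p : _ ∉ verts p
      x∉p x∈p with splitAt p x∈p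
      ... | α , β , p≡ = no-return e α β (subst (λ q → NonBacktracking (e ∷ q)) p≡ nb)
                                          (proj₁ (IsPath-++ᵂ⁻ α β (subst IsPath p≡ path)))

  Diverge : ∀ {s x y} → W s x → W s y → Set
  Diverge (_∷_ {y = u} _ _) (_∷_ {y = v} _ _) = u ≢ v
  Diverge _                 _                 = ⊤

  NonBacktracking-ʳ++ᵂ : ∀ {s x y} (q : W s x) (p : W s y) →
                         NonBacktracking q → NonBacktracking p → Diverge q p → NonBacktracking (q ʳ++ᵂ p)
  NonBacktracking-ʳ++ᵂ []      p _   nbp _  = nbp
  NonBacktracking-ʳ++ᵂ (e ∷ q) p nbq nbp dv =
    NonBacktracking-ʳ++ᵂ q (adj-sym e ∷ p) (NonBacktracking-tail e q nbq) (extend p nbp dv) (diverge q nbq)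
    where
      extend : ∀ {y} (p : W _ y) → NonBacktracking p → Diverge (e ∷ q) p → NonBacktracking (adj-sym e ∷ p)
      extend []      _   _  = tt
      extend (_ ∷ _) nbp dv = dv , nbp
      diverge : ∀ {x} (q : W _ x) → NonBacktracking (e ∷ q) → Diverge q (adj-sym e ∷ p)
      diverge []      _         = tt
      diverge (_ ∷ _) (s≢u , _) = s≢u ∘ sym

  closed-path⇒len≡0 : ∀ {x} (c : W x x) → IsPath c → len c ≡ 0
  closed-path⇒len≡0 []      _        = refl
  closed-path⇒len≡0 (e ∷ c) (x∉ ∷ _) = ⊥-elim (All.lookup x∉ (end∈verts c) refl)

  -- Two paths leaving x along different edges glue, the first one reversed, to a non-backtracking
  -- closed walk; in a tree that walk is a path, so it cannot have positive length.
  path-unique : ∀ {x y} (p q : W x y) → IsPath p → IsPath q → verts p ≡ verts q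
  path-unique []      []      _ _ = refl
  path-unique []      (e ∷ q) _ q-path with () ← closed-path⇒len≡0 (e ∷ q) q-path
  path-unique (e ∷ p) []      p-path _ with () ← closed-path⇒len≡0 (e ∷ p) p-path
  path-unique (_∷_ {y = u} e p) (_∷_ {y = v} f q) p-path q-path with u ≟ v
  ... | yes refl = cong (_ ∷_) (path-unique p q (AllPairs.tail p-path) (AllPairs.tail q-path))
  ... | no u≢v   =
    contradiction (trans (sym (len-ʳ++ᵂ (e ∷ p) (f ∷ q))) (closed-path⇒len≡0 _ (NonBacktracking⇒IsPath _ nb))) λ ()
    where
      nb : NonBacktracking ((e ∷ p) ʳ++ᵂ (f ∷ q))
      nb = NonBacktracking-ʳ++ᵂ (e ∷ p) (f ∷ q) (IsPath⇒NonBacktracking _ p-path) (IsPath⇒NonBacktracking _ q-path) u≢v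

  toPath : ∀ {x y} → W x y → ∃ λ (p : W x y) → IsPath p
  toPath []          = [] , [] ∷ []
  toPath {x} (e ∷ p) with toPath p
  ... | p′ , path with x ∈? verts p′
  ...   | no x∉  = e ∷ p′ , All.¬Any⇒All¬ _ x∉ ∷ path
  ...   | yes x∈ with splitAt p′ x∈
  ...     | α , β , refl = β , proj₂ (IsPath-++ᵂ⁻ α β path)

module _ {A : Set} (_≤_ : Rel A 0ℓ) (≤-refl : Reflexive _≤_) (≤-trans : Transitive _≤_) where

  argmax? : ∀ {n} {P : Pred (Fin n) 0ℓ} → Decidable₁ P → (f : Fin n → A) →
            (∀ {i j} → P i → P j → f i ≤ f j ⊎ f j ≤ f i) →
            (∀ i → ¬ P i) ⊎ ∃ λ i → P i × ∀ {j} → P j → f j ≤ f i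
  argmax? {zero}  P? f comparable = inj₁ λ ()
  argmax? {suc n} P? f comparable with argmax? (P? ∘ suc) (f ∘ suc) comparable | P? zero
  ... | inj₁ none           | no ¬p₀ = inj₁ λ { zero → ¬p₀ ; (suc i) → none i }
  ... | inj₁ none           | yes p₀ =
    inj₂ (zero , p₀ , λ { {zero} _ → ≤-refl ; {suc j} pj → contradiction pj (none j) })
  ... | inj₂ (i , pᵢ , max) | no ¬p₀ =
    inj₂ (suc i , pᵢ , λ { {zero} p₀ → contradiction p₀ ¬p₀ ; {suc j} pj → max pj })
  ... | inj₂ (i , pᵢ , max) | yes p₀ with comparable p₀ pᵢ
  ...   | inj₁ f₀≤fᵢ = inj₂ (suc i , pᵢ , λ { {zero} _ → f₀≤fᵢ ; {suc j} pj → max pj })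
  ...   | inj₂ fᵢ≤f₀ = inj₂ (zero , p₀ , λ { {zero} _ → ≤-refl ; {suc j} pj → ≤-trans (max pj) fᵢ≤f₀ })

  -- Opaque, since unfolding the search makes type checking its uses very slow.
  opaque
    argmax : ∀ {n} {P : Pred (Fin n) 0ℓ} → Decidable₁ P → (f : Fin n → A) →
             (∀ {i j} → P i → P j → f i ≤ f j ⊎ f j ≤ f i) →
             ∃ P → ∃ λ i → P i × ∀ {j} → P j → f j ≤ f i
    argmax P? f comparable (i , pᵢ) with argmax? P? f comparable
    ... | inj₁ none = contradiction pᵢ (none i)
    ... | inj₂ max  = max

    argmax-all : ∀ {n} (f : Fin n → A) → (∀ i j → f i ≤ f j ⊎ f j ≤ f i) →
                 Fin n → ∃ λ i → ∀ j → f j ≤ f i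
    argmax-all f comparable i₀ with argmax (λ _ → yes tt) f (λ {i} {j} _ _ → comparable i j) (i₀ , tt)
    ... | i , _ , max = i , λ _ → max tt

record IsTreeOrder {V : Set} (_≼_ : Rel V 0ℓ) (_∧_ : Op₂ V) : Set where
  field
    isMeetSemilattice : IsMeetSemilattice _≡_ _≼_ _∧_
    _≼?_              : Decidable _≼_
    ≼-linear-below    : ∀ {u v x} → u ≼ x → v ≼ x → u ≼ v ⊎ v ≼ u

  open IsMeetSemilattice isMeetSemilattice public
    using (∧-greatest)
    renaming (refl to ≼-refl; trans to ≼-trans; antisym to ≼-antisym; x∧y≤x to x∧y≼x; x∧y≤y to x∧y≼y)

module _ {V : Set} {_≼_ : Rel V 0ℓ} {_∧_ : Op₂ V} (tree : IsTreeOrder _≼_ _∧_) where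

  open IsTreeOrder tree

  ∧-outside-≼ : ∀ {u x y z} → u ≼ x → u ≼ y → ¬ u ≼ z → (x ∧ z) ≼ (y ∧ z)
  ∧-outside-≼ {u} {x} {y} {z} u≼x u≼y u⋠z with ≼-linear-below u≼x (x∧y≼x x z)
  ... | inj₁ u≼x∧z = contradiction (≼-trans u≼x∧z (x∧y≼y x z)) u⋠z
  ... | inj₂ x∧z≼u = ∧-greatest (≼-trans x∧z≼u u≼y) (x∧y≼y x z)

  ∧-outside : ∀ {u x y z} → u ≼ x → u ≼ y → ¬ u ≼ z → x ∧ z ≡ y ∧ z
  ∧-outside u≼x u≼y u⋠z = ≼-antisym (∧-outside-≼ u≼x u≼y u⋠z) (∧-outside-≼ u≼y u≼x u⋠z)

module _ {V : Set} (_∧_ : Op₂ V) (δ : V → ℚ) where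

  open import Data.Rational using (_+_; _-_)

  -- The length of the tree path from x up to x ∧ y and down to y, when δ is the depth from a root.
  treeDist : V → V → ℚ
  treeDist x y = (δ x - δ (x ∧ y)) + (δ y - δ (x ∧ y))

  treeDist-split : ∀ {x z j} → x ∧ z ≡ j → treeDist x z ≡ ((δ x - δ j) - δ j) + δ z
  treeDist-split {x} {z} refl =
    solve 3 (λ a b c → (a :- c) :+ (b :- c) := ((a :- c) :- c) :+ b) refl (δ x) (δ z) (δ (x ∧ z))
    where open ℚ-Solver

module Rooted {t : ℕ} (T : WTree t) (r : Fin t) where

  open WTree T
  open Walks {Fin t} {Adj}
  open Trees T
  open DecMembership (_≟_ {t}) using (_∈?_)
  open import Data.Rational using (_+_; _-_)

  private
    W : Fin t → Fin t → Set
    W = Walk Adj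

  rootPath : ∀ v → W v r
  rootPath v = proj₁ (toPath (connected v r))

  rootPath-isPath : ∀ v → IsPath (rootPath v)
  rootPath-isPath v = proj₂ (toPath (connected v r))

  rootPath-unique : ∀ {v} (p : W v r) → IsPath p → verts p ≡ verts (rootPath v)
  rootPath-unique p path = path-unique p (rootPath _) path (rootPath-isPath _)

  rootPath-suffix : ∀ {v z} (α : W v z) (β : W z r) → rootPath v ≡ α ++ᵂ β → verts β ≡ verts (rootPath z)
  rootPath-suffix α β eq = rootPath-unique β (proj₂ (IsPath-++ᵂ⁻ α β (subst IsPath eq (rootPath-isPath _))))

  depth : Fin t → ℚ
  depth v = weight w (rootPath v)

  weight-rootPath-prefix : ∀ {v z} (α : W v z) (β : W z r) → rootPath v ≡ α ++ᵂ β → weight w α ≡ depth v - depth z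
  weight-rootPath-prefix {v} {z} α β eq = begin
    weight w α                          ≡⟨ solve 2 (λ a d → a := (a :+ d) :- d) refl (weight w α) (depth z) ⟩
    (weight w α + depth z) - depth z    ≡⟨ cong (λ d → (weight w α + d) - depth z)
                                                (weight-cong w β (rootPath z) (rootPath-suffix α β eq)) ⟨
    (weight w α + weight w β) - depth z ≡⟨ cong (_- depth z) (trans (cong (weight w) eq) (weight-++ᵂ w α β)) ⟨
    depth v - depth z                   ∎
    where
      open ≡-Reasoning
      open ℚ-Solver

  infix 4 _≼_ _≼?_

  _≼_ : Rel (Fin t) 0ℓ
  u ≼ v = u ∈ verts (rootPath v)

  _≼?_ : Decidable _≼_
  u ≼? v = u ∈? verts (rootPath v)

  height : Fin t → ℕ
  height v = length (verts (rootPath v))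

  ≼-suffix : ∀ {u v} → u ≼ v → ∃ λ pre → verts (rootPath v) ≡ pre ++ verts (rootPath u)
  ≼-suffix {u} {v} u≼v with splitAt (rootPath v) u≼v
  ... | α , β , eq = initVerts α , (begin
    verts (rootPath v)                ≡⟨ cong verts eq ⟩
    verts (α ++ᵂ β)                   ≡⟨ verts-++ᵂ α β ⟩
    initVerts α ++ verts β            ≡⟨ cong (initVerts α ++_) (rootPath-suffix α β eq) ⟩
    initVerts α ++ verts (rootPath u) ∎)
    where open ≡-Reasoning

  ≼-height : ∀ {u v} → u ≼ v → u ≡ v ⊎ height u < height v
  ≼-height {u} {v} u≼v with ≼-suffix u≼v
  ... | []      , eq = inj₁ (start-unique (rootPath u) (rootPath v) (sym eq))
  ... | a ∷ pre , eq = inj₂ (subst (height u <_) (cong length (sym eq))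
                              (s≤s (subst (height u ≤_) (sym (length-++ pre)) (ℕ.m≤n+m _ (length pre)))))

  ≼-refl : ∀ {v} → v ≼ v
  ≼-refl = start∈verts (rootPath _)

  ≼-trans : ∀ {u v x} → u ≼ v → v ≼ x → u ≼ x
  ≼-trans u≼v v≼x with ≼-suffix v≼x
  ... | pre , eq = subst (_ ∈_) (sym eq) (∈-++⁺ʳ pre u≼v)

  ≼-antisym : ∀ {u v} → u ≼ v → v ≼ u → u ≡ v
  ≼-antisym u≼v v≼u with ≼-height u≼v | ≼-height v≼u
  ... | inj₁ u≡v | _        = u≡v
  ... | inj₂ _   | inj₁ v≡u = sym v≡u
  ... | inj₂ u<v | inj₂ v<u = contradiction u<v (ℕ.<⇒≯ v<u)

  ≼-linear-below : ∀ {u v x} → u ≼ x → v ≼ x → u ≼ v ⊎ v ≼ u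
  ≼-linear-below u≼x v≼x with ≼-suffix u≼x | ≼-suffix v≼x
  ... | pre , eq | pre′ , eq′ with ++-≡-++⇒suffix pre pre′ (trans (sym eq) eq′)
  ...   | inj₁ (cs , e) = inj₂ (subst (_ ∈_) (sym e) (∈-++⁺ʳ cs ≼-refl))
  ...   | inj₂ (cs , e) = inj₁ (subst (_ ∈_) (sym e) (∈-++⁺ʳ cs ≼-refl))

  root-≼ : ∀ v → r ≼ v
  root-≼ v = end∈verts (rootPath v)

  private
    meetSplit : ∀ x y → ∃ λ z → z ≼ y × ∃ λ (α : W x z) → All (λ v → ¬ v ≼ y) (initVerts α) ×
                                          ∃ λ (β : W z r) → rootPath x ≡ α ++ᵂ β
    meetSplit x y = splitAtFirst (_≼? y) (rootPath x) (root-≼ y)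

  infixr 7 _∧_

  _∧_ : Op₂ (Fin t)
  x ∧ y = proj₁ (meetSplit x y)

  x∧y≼x : ∀ x y → x ∧ y ≼ x
  x∧y≼x x y with meetSplit x y
  ... | z , _ , α , _ , β , eq =
    subst (z ∈_) (sym (trans (cong verts eq) (verts-++ᵂ α β))) (∈-++⁺ʳ (initVerts α) (start∈verts β))

  x∧y≼y : ∀ x y → x ∧ y ≼ y
  x∧y≼y x y = proj₁ (proj₂ (meetSplit x y))

  ∧-greatest : ∀ {v x y} → v ≼ x → v ≼ y → v ≼ x ∧ y
  ∧-greatest {v} {x} {y} v≼x v≼y with meetSplit x y
  ... | z , _ , α , below-α , β , eq
    with ∈-++⁻ (initVerts α) (subst (v ∈_) (trans (cong verts eq) (verts-++ᵂ α β)) v≼x)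
  ...   | inj₁ v∈α = contradiction v≼y (All.lookup below-α v∈α)
  ...   | inj₂ v∈β = subst (v ∈_) (rootPath-suffix α β eq) v∈β

  isTreeOrder : IsTreeOrder _≼_ _∧_
  isTreeOrder = record
    { isMeetSemilattice = record
      { isPartialOrder = record
        { isPreorder = record
          { isEquivalence = isEquivalence
          ; reflexive     = λ { refl → ≼-refl }
          ; trans         = ≼-trans
          }
        ; antisym = ≼-antisym
        }
      ; infimum = λ x y → x∧y≼x x y , x∧y≼y x y , λ v → ∧-greatest
      }
    ; _≼?_           = _≼?_
    ; ≼-linear-below = ≼-linear-below
    }

  path-weight : ∀ {x y} (p : W x y) → IsPath p → weight w p ≡ treeDist _∧_ depth x y
  path-weight {x} {y} p path with meetSplit x y
  ... | z , z≼y , α , below-α , β , eq with splitAt (rootPath y) z≼y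
  ...   | α′ , β′ , eq′ = begin
    weight w p                                ≡⟨ weight-cong w p γ (path-unique p γ path γ-isPath) ⟩
    weight w (α ++ᵂ reverseᵂ α′)              ≡⟨ weight-++ᵂ w α (reverseᵂ α′) ⟩
    weight w α + weight w (reverseᵂ α′)       ≡⟨ cong (weight w α +_) (weight-reverseᵂ α′) ⟩
    weight w α + weight w α′                  ≡⟨ cong₂ _+_ (weight-rootPath-prefix α β eq)
                                                              (weight-rootPath-prefix α′ β′ eq′) ⟩
    (depth x - depth z) + (depth y - depth z) ∎
    where
      open ≡-Reasoning
      γ : W x y
      γ = α ++ᵂ reverseᵂ α′
      α-isPath : IsPath α
      α-isPath = proj₁ (IsPath-++ᵂ⁻ α β (subst IsPath eq (rootPath-isPath x)))
      α′-isPath : IsPath α′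
      α′-isPath = proj₁ (IsPath-++ᵂ⁻ α′ β′ (subst IsPath eq′ (rootPath-isPath y)))
      α′-≼y : ∀ {v} → v ∈ verts α′ → v ≼ y
      α′-≼y v∈ = subst (_ ∈_) (sym (trans (cong verts eq′) (verts-++ᵂ-dropFirst α′ β′))) (∈-++⁺ˡ v∈)
      γ-isPath : IsPath γ
      γ-isPath = IsPath-++ᵂ⁺ α (reverseᵂ α′) α-isPath (IsPath-reverseᵂ α′ α′-isPath)
        λ (v∈α , v∈α′) →
          All.lookup below-α v∈α (α′-≼y (Any.reverse⁻ (subst (_ ∈_) (verts-reverseᵂ α′) v∈α′)))

  parent-or-child : ∀ {x z} → Adj x z →
                    verts (rootPath x) ≡ x ∷ verts (rootPath z) ⊎ verts (rootPath z) ≡ z ∷ verts (rootPath x)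
  parent-or-child {x} {z} e with x ≼? z
  ... | no x⋠z = inj₁ (sym (rootPath-unique (e ∷ rootPath z) (All.¬Any⇒All¬ _ x⋠z ∷ rootPath-isPath z)))
  ... | yes x≼z with splitAt (rootPath z) x≼z
  ...   | α , β , eq = inj₂ (begin
    verts (rootPath z)     ≡⟨ cong verts eq ⟩
    verts (α ++ᵂ β)        ≡⟨ verts-++ᵂ α β ⟩
    initVerts α ++ verts β ≡⟨ cong₂ _++_ α-edge (rootPath-suffix α β eq) ⟩
    z ∷ verts (rootPath x) ∎)
    where
      open ≡-Reasoning
      edge : W z x
      edge = adj-sym e ∷ []
      edge-isPath : IsPath edge
      edge-isPath = ((λ z≡x → adj-irr (subst (Adj x) z≡x e)) ∷ []) ∷ [] ∷ []
      α-isPath : IsPath α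
      α-isPath = proj₁ (IsPath-++ᵂ⁻ α β (subst IsPath eq (rootPath-isPath z)))
      α-edge : initVerts α ≡ [ z ]
      α-edge = ∷ʳ-injectiveˡ (initVerts α) [ z ] (begin
        initVerts α ++ [ x ] ≡⟨ verts-initVerts α ⟨
        verts α              ≡⟨ path-unique α edge α-isPath edge-isPath ⟩
        z ∷ x ∷ []           ∎)

  -- A vertex of greatest height is a leaf: each of its neighbours is its parent.
  leaf-other-than-root : ∀ {y} → y ≢ r → ∃ λ x → IsLeaf T x × x ≢ r
  leaf-other-than-root {y} y≢r = x , (proj₁ step , proj₂ step , λ z e → parent-unique e (proj₂ step)) , x≢r
    where
      highest : ∃ λ x → ∀ v → height v ≤ height x
      highest = argmax-all _≤_ ℕ.≤-refl ℕ.≤-trans height (λ i j → ℕ.≤-total (height i) (height j)) r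
      x : Fin t
      x = proj₁ highest
      x-highest : ∀ v → height v ≤ height x
      x-highest = proj₂ highest
      x≢r : x ≢ r
      x≢r x≡r with ≼-height (root-≼ y)
      ... | inj₁ r≡y = y≢r (sym r≡y)
      ... | inj₂ r<y = ℕ.<-irrefl (cong height (sym x≡r)) (ℕ.<-≤-trans r<y (x-highest y))
      step : ∃ (Adj x)
      step = first-step (rootPath x) x≢r
      parent : ∀ {z} → Adj x z → verts (rootPath x) ≡ x ∷ verts (rootPath z)
      parent {z} e with parent-or-child e
      ... | inj₁ eq = eq
      ... | inj₂ eq = contradiction (x-highest z) (ℕ.<⇒≱ (ℕ.≤-reflexive (sym (cong length eq))))
      parent-unique : ∀ {z u} → Adj x z → Adj x u → z ≡ u
      parent-unique {z} {u} e f = start-unique (rootPath z) (rootPath u) (∷-injectiveʳ (trans (sym (parent e)) (parent f)))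

module _ (I : Interval) where

  open Interval I
  open Data.Rational using () renaming (_≤_ to _≤ℚ_)

  data Side (q : ℚ) : Set where
    before : ¬ mem q → (∀ {p} → mem p → ¬ p ≤ℚ q) → Side q
    inside : mem q → Side q
    after  : ¬ mem q → (p : ℚ) → mem p → p ≤ℚ q → Side q

  rank : ∀ {q} → Side q → ℕ
  rank (before _ _)    = 0
  rank (inside _)      = 1
  rank (after _ _ _ _) = 2

  rank≤2 : ∀ {q} (s : Side q) → rank s ≤ 2
  rank≤2 (before _ _)    = z≤n
  rank≤2 (inside _)      = s≤s z≤n
  rank≤2 (after _ _ _ _) = s≤s (s≤s z≤n)

  rank-mono : ∀ {q q′} → q ≤ℚ q′ → (s : Side q) (s′ : Side q′) → rank s ≤ rank s′
  rank-mono q≤q′ (before _ _)        _               = z≤n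
  rank-mono q≤q′ (inside _)          (inside _)      = ℕ.≤-refl
  rank-mono q≤q′ (inside _)          (after _ _ _ _) = s≤s z≤n
  rank-mono q≤q′ (inside m)          (before _ none) = contradiction q≤q′ (none m)
  rank-mono q≤q′ (after ¬m p mp p≤q) (inside m′)     = contradiction (convex p _ _ mp m′ p≤q q≤q′) ¬m
  rank-mono q≤q′ (after _ _ _ _)     (after _ _ _ _) = ℕ.≤-refl
  rank-mono q≤q′ (after _ p mp p≤q)  (before _ none) = contradiction (ℚ.≤-trans p≤q q≤q′) (none mp)

  rank≡1⇒mem : ∀ {q} (s : Side q) → rank s ≡ 1 → mem q
  rank≡1⇒mem (inside m) _ = m

  mem⇒rank≡1 : ∀ {q} (s : Side q) → mem q → rank s ≡ 1
  mem⇒rank≡1 (before ¬m _)    m = contradiction m ¬m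
  mem⇒rank≡1 (inside _)       _ = refl
  mem⇒rank≡1 (after ¬m _ _ _) m = contradiction m ¬m

  ¬¬side : ∀ {q} → ¬ ¬ Side q
  ¬¬side k = k (before ∉I λ mp p≤q → k (after ∉I _ mp p≤q))
    where
      ∉I : ¬ mem _
      ∉I m = k (inside m)

module _ where

  open Data.Nat using (_+_)

  ∑ : ∀ {n} → (Fin n → ℕ) → ℕ
  ∑ {zero}  f = 0
  ∑ {suc n} f = f zero + ∑ (f ∘ suc)

  ∑-mono-≤ : ∀ {n} {f g : Fin n → ℕ} → (∀ i → f i ≤ g i) → ∑ f ≤ ∑ g
  ∑-mono-≤ {zero}  f≤g = z≤n
  ∑-mono-≤ {suc n} f≤g = ℕ.+-mono-≤ (f≤g zero) (∑-mono-≤ (f≤g ∘ suc))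

  ∑-≤ : ∀ {n c} {f : Fin n → ℕ} → (∀ i → f i ≤ c) → ∑ f ≤ n * c
  ∑-≤ {zero}  f≤c = z≤n
  ∑-≤ {suc n} f≤c = ℕ.+-mono-≤ (f≤c zero) (∑-≤ (f≤c ∘ suc))

  +-rigid : ∀ {a b c d} → a ≤ c → b ≤ d → a + b ≡ c + d → a ≡ c × b ≡ d
  +-rigid {a} {b} {c} {d} a≤c b≤d eq = a≡c , ℕ.+-cancelˡ-≡ c b d (subst (λ x → x + b ≡ c + d) a≡c eq)
    where
      a≡c : a ≡ c
      a≡c = ℕ.≤-antisym a≤c
              (ℕ.+-cancelʳ-≤ b c a (ℕ.≤-trans (ℕ.+-monoʳ-≤ c b≤d) (ℕ.≤-reflexive (sym eq))))

  ∑-rigid : ∀ {n} {f g : Fin n → ℕ} → (∀ i → f i ≤ g i) → ∑ f ≡ ∑ g → ∀ i → f i ≡ g i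
  ∑-rigid {suc n} f≤g eq zero    = proj₁ (+-rigid (f≤g zero) (∑-mono-≤ (f≤g ∘ suc)) eq)
  ∑-rigid {suc n} f≤g eq (suc i) = ∑-rigid (f≤g ∘ suc) (proj₂ (+-rigid (f≤g zero) (∑-mono-≤ (f≤g ∘ suc)) eq)) i

  ∑∑-rigid : ∀ {m n} {f g : Fin m → Fin n → ℕ} →
             (∀ a i → f a i ≤ g a i) ⊎ (∀ a i → g a i ≤ f a i) →
             ∑ (∑ ∘ f) ≡ ∑ (∑ ∘ g) → ∀ a i → f a i ≡ g a i
  ∑∑-rigid (inj₁ f≤g) eq a   = ∑-rigid (f≤g a) (∑-rigid (∑-mono-≤ ∘ f≤g) eq a)
  ∑∑-rigid (inj₂ g≤f) eq a i = sym (∑∑-rigid (inj₁ g≤f) (sym eq) a i)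

module LeafClusters
  {V : Set} {_≼_ : Rel V 0ℓ} {_∧_ : Op₂ V} (tree : IsTreeOrder _≼_ _∧_) {n : ℕ} (A : Fin n → V)
  where

  open IsTreeOrder tree

  least : ∀ {P : Pred (Fin n) 0ℓ} → Decidable₁ P → ∃ P → ∃ λ i → P i × ∀ {j} → P j → i ≤ᶠ j
  least P? = argmax (flip _≤ᶠ_) Fin.≤-refl (flip Fin.≤-trans) P? id (λ {i} {j} _ _ → Fin.≤-total j i)

  module Cluster (v : V) {a₀ : Fin n} (v≼a₀ : v ≼ A a₀) where

    Below : Pred (Fin n) 0ℓ
    Below a = v ≼ A a

    opaque
      private
        first : ∃ λ c → Below c × ∀ {a} → Below a → c ≤ᶠ a
        first = least (λ a → v ≼? A a) (a₀ , v≼a₀)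

      firstLeaf : Fin n
      firstLeaf = proj₁ first

      firstLeaf-below : Below firstLeaf
      firstLeaf-below = proj₁ (proj₂ first)

      firstLeaf-least : ∀ {a} → Below a → firstLeaf ≤ᶠ a
      firstLeaf-least = proj₂ (proj₂ first)

      private
        spanning : ∃ λ s → Below s × ∀ {a} → Below a → (A firstLeaf ∧ A s) ≼ (A firstLeaf ∧ A a)
        spanning = argmax (flip _≼_) ≼-refl (flip ≼-trans) (λ a → v ≼? A a) (λ a → A firstLeaf ∧ A a)
                     (λ _ _ → Sum.swap (≼-linear-below (x∧y≼x _ _) (x∧y≼x _ _))) (firstLeaf , firstLeaf-below)

      span : V
      span = A firstLeaf ∧ A (proj₁ spanning)

      span-minimal : ∀ {a} → Below a → span ≼ (A firstLeaf ∧ A a)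
      span-minimal = proj₂ (proj₂ spanning)

      ≼-span : v ≼ span
      ≼-span = ∧-greatest firstLeaf-below (proj₁ (proj₂ spanning))

      span-≼ : ∀ {a} → Below a → span ≼ A a
      span-≼ below = ≼-trans (span-minimal below) (x∧y≼y _ _)

      span-below : ∀ {a} → span ≼ A a → Below a
      span-below = ≼-trans ≼-span

      private
        Spanning : Pred (Fin n) 0ℓ
        Spanning a = Below a × (A firstLeaf ∧ A a) ≼ span

        leastSpanning : ∃ λ y → Spanning y × ∀ {a} → Spanning a → y ≤ᶠ a
        leastSpanning = least (λ a → (v ≼? A a) ×-dec ((A firstLeaf ∧ A a) ≼? span))
                          (proj₁ spanning , proj₁ (proj₂ spanning) , ≼-refl)

      representative : Fin n
      representative = proj₁ leastSpanning

      representative-below : Below representative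
      representative-below = proj₁ (proj₁ (proj₂ leastSpanning))

      representative-least : ∀ {a} → Below a → (A firstLeaf ∧ A a) ≼ span → representative ≤ᶠ a
      representative-least below spans = proj₂ (proj₂ leastSpanning) (below , spans)

      firstLeaf∧representative : A firstLeaf ∧ A representative ≡ span
      firstLeaf∧representative = ≼-antisym (proj₂ (proj₁ (proj₂ leastSpanning))) (span-minimal representative-below)

    span-≼-representative : span ≼ A representative
    span-≼-representative = span-≼ representative-below

    -- Singleton clusters are named by their leaf, the others by their least leaf outside the branch
    -- of firstLeaf below span.
    key : Fin n ⊎ Fin n
    key with representative ≟ firstLeaf
    ... | yes _ = inj₁ representative
    ... | no _  = inj₂ representative

    key-singleton : representative ≡ firstLeaf → key ≡ inj₁ representative
    key-singleton y≡c with representative ≟ firstLeaf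
    ... | yes _   = refl
    ... | no y≢c = contradiction y≡c y≢c

    key-branching : representative ≢ firstLeaf → key ≡ inj₂ representative
    key-branching y≢c with representative ≟ firstLeaf
    ... | yes y≡c = contradiction y≡c y≢c
    ... | no _    = refl

    representative-key : [ id , id ]′ key ≡ representative
    representative-key with representative ≟ firstLeaf
    ... | yes _ = refl
    ... | no _  = refl

  module _ {v v′ a a′} (p : v ≼ A a) (p′ : v′ ≼ A a′) where

    private
      module C  = Cluster v p
      module C′ = Cluster v′ p′

    key⇒representative : C.key ≡ C′.key → C.representative ≡ C′.representative
    key⇒representative same = trans (sym C.representative-key) (trans (cong [ id , id ]′ same) C′.representative-key)

    key⇒span-≼⇒≡ : C.key ≡ C′.key → C.span ≼ C′.span → C.span ≡ C′.span
    key⇒span-≼⇒≡ same span≼span′ with C.firstLeaf ≟ C′.firstLeaf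
    ... | yes c≡c′ = begin
      C.span                               ≡⟨ C.firstLeaf∧representative ⟨
      A C.firstLeaf ∧ A C.representative   ≡⟨ cong₂ (λ i j → A i ∧ A j) c≡c′ (key⇒representative same) ⟩
      A C′.firstLeaf ∧ A C′.representative ≡⟨ C′.firstLeaf∧representative ⟩
      C′.span                              ∎
      where open ≡-Reasoning
    ... | no c≢c′ = contradiction (trans (sym (C.key-branching y≢c)) (trans same (C′.key-singleton y′≡c′))) λ ()
      where
        same-rep : C.representative ≡ C′.representative
        same-rep = key⇒representative same
        c′-below : C.Below C′.firstLeaf
        c′-below = C.span-below (≼-trans span≼span′ (C′.span-≼ C′.firstLeaf-below))
        c-not-below′ : ¬ C′.Below C.firstLeaf
        c-not-below′ below = c≢c′ (Fin.≤-antisym (C.firstLeaf-least c′-below) (C′.firstLeaf-least below))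
        X : V
        X = A C.firstLeaf ∧ A C′.firstLeaf
        X≼span′ : X ≼ C′.span
        X≼span′ with ≼-linear-below (C′.span-≼ C′.firstLeaf-below) (x∧y≼y (A C.firstLeaf) (A C′.firstLeaf))
        ... | inj₁ span′≼X = contradiction (C′.span-below (≼-trans span′≼X (x∧y≼x _ _))) c-not-below′
        ... | inj₂ X≼span′ = X≼span′
        X≼span : X ≼ C.span
        X≼span = subst (X ≼_) C.firstLeaf∧representative
          (∧-greatest (x∧y≼x _ _)
                      (≼-trans X≼span′ (subst (λ i → C′.span ≼ A i) (sym same-rep) C′.span-≼-representative)))
        y′≡c′ : C′.representative ≡ C′.firstLeaf
        y′≡c′ = Fin.≤-antisym (subst (_≤ᶠ C′.firstLeaf) same-rep (C.representative-least c′-below X≼span))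
                              (C′.firstLeaf-least C′.representative-below)
        y≢c : C.representative ≢ C.firstLeaf
        y≢c y≡c = c≢c′ (trans (sym y≡c) (trans same-rep y′≡c′))

  key-injective : ∀ {v v′ a a′} (p : v ≼ A a) (p′ : v′ ≼ A a′) →
                  Cluster.key v p ≡ Cluster.key v′ p′ → Cluster.span v p ≡ Cluster.span v′ p′
  key-injective p p′ same
    with ≼-linear-below (Cluster.span-≼-representative _ p)
                        (subst (λ i → Cluster.span _ p′ ≼ A i) (sym (key⇒representative p p′ same))
                               (Cluster.span-≼-representative _ p′))
  ... | inj₁ span≼span′ = key⇒span-≼⇒≡ p p′ same span≼span′
  ... | inj₂ span′≼span = sym (key⇒span-≼⇒≡ p′ p (sym same) span′≼span)

module TreeRealisation
  {V : Set} {_≼_ : Rel V 0ℓ} {_∧_ : Op₂ V} (tree : IsTreeOrder _≼_ _∧_) (δ : V → ℚ)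
  {m k ℓ : ℕ} (A : Fin m → V) (a₀ : Fin m) (B : Fin k → V) (I : Fin ℓ → Interval)
  (S : Fin k → Subset m) (S-injective : ∀ b b′ → S b ≡ S b′ → b ≡ b′)
  (S-realised : ∀ b a → a ∈ˢ S b ⇔ ∃ λ i → Interval.mem (I i) (treeDist _∧_ δ (B b) (A a)))
  (side : ∀ b a i → Side (I i) (treeDist _∧_ δ (B b) (A a)))
  where

  open IsTreeOrder tree
  open LeafClusters tree A
  open Data.Nat using (_+_)
  open Data.Fin using (combine; join; splitAt; fromℕ<)
  open Data.Rational using (_-_; -_) renaming (_≤_ to _≤ℚ_)

  private
    dist : V → V → ℚ
    dist = treeDist _∧_ δ

    deepest : ∀ b → ∃ λ a → ∀ a′ → (B b ∧ A a′) ≼ (B b ∧ A a)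
    deepest b = argmax-all _≼_ ≼-refl ≼-trans (λ a → B b ∧ A a)
                  (λ _ _ → ≼-linear-below (x∧y≼x _ _) (x∧y≼x _ _)) a₀

  junction : Fin k → V
  junction b = B b ∧ A (proj₁ (deepest b))

  junction-deepest : ∀ b a → (B b ∧ A a) ≼ junction b
  junction-deepest b = proj₂ (deepest b)

  junction-≼-leaf : ∀ b → junction b ≼ A (proj₁ (deepest b))
  junction-≼-leaf b = x∧y≼y _ _

  module ClusterOf (b : Fin k) = Cluster (junction b) (junction-≼-leaf b)

  cluster : Fin k → V
  cluster = ClusterOf.span

  key : Fin k → Fin m ⊎ Fin m
  key = ClusterOf.key

  same-cluster : ∀ {b b′} → key b ≡ key b′ → cluster b ≡ cluster b′
  same-cluster {b} {b′} = key-injective (junction-≼-leaf b) (junction-≼-leaf b′)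

  same-representative : ∀ {b b′} → key b ≡ key b′ → ClusterOf.representative b ≡ ClusterOf.representative b′
  same-representative {b} {b′} = key⇒representative (junction-≼-leaf b) (junction-≼-leaf b′)

  meet-inside : ∀ {b a} → cluster b ≼ A a → B b ∧ A a ≡ junction b
  meet-inside {b} c≼a = ≼-antisym (junction-deepest b _) (∧-greatest (x∧y≼x _ _) (ClusterOf.span-below b c≼a))

  meet-outside : ∀ {b a} → ¬ cluster b ≼ A a → B b ∧ A a ≡ A (ClusterOf.representative b) ∧ A a
  meet-outside {b} c⋠a =
    ∧-outside tree (x∧y≼x _ _) (≼-trans (ClusterOf.≼-span b) (ClusterOf.span-≼-representative b))
                   (c⋠a ∘ ClusterOf.span-≼ b)

  insideShift : Fin k → ℚ
  insideShift b = (δ (B b) - δ (junction b)) - δ (junction b)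

  dist-inside-≤ : ∀ {b b′ a} → cluster b ≼ A a → cluster b′ ≼ A a → insideShift b ≤ℚ insideShift b′ →
                  dist (B b) (A a) ≤ℚ dist (B b′) (A a)
  dist-inside-≤ {b} {b′} {a} c≼a c′≼a le =
    subst₂ _≤ℚ_ (sym (treeDist-split _∧_ δ (meet-inside c≼a))) (sym (treeDist-split _∧_ δ (meet-inside c′≼a)))
      (ℚ.+-monoˡ-≤ (δ (A a)) le)

  dist-outside-≤ : ∀ {b b′ a} → key b ≡ key b′ → ¬ cluster b ≼ A a → δ (B b) ≤ℚ δ (B b′) →
                   dist (B b) (A a) ≤ℚ dist (B b′) (A a)
  dist-outside-≤ {b} {b′} {a} same c⋠a le =
    subst₂ _≤ℚ_ (sym (treeDist-split _∧_ δ (meet-outside c⋠a)))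
                (sym (treeDist-split _∧_ δ (trans (meet-outside c′⋠a)
                                                  (cong (λ y → A y ∧ A a) (sym (same-representative same))))))
      (ℚ.+-monoˡ-≤ (δ (A a)) (ℚ.+-monoˡ-≤ (- j) (ℚ.+-monoˡ-≤ (- j) le)))
    where
      j : ℚ
      j = δ (A (ClusterOf.representative b) ∧ A a)
      c′⋠a : ¬ cluster b′ ≼ A a
      c′⋠a = c⋠a ∘ subst (_≼ A a) (sym (same-cluster same))

  rankAt : Fin k → Fin m → Fin ℓ → ℕ
  rankAt b a i = rank (I i) (side b a i)

  rankInside rankOutside : Fin k → Fin m → Fin ℓ → ℕ
  rankInside  b a i = if does (cluster b ≼? A a) then rankAt b a i else 0
  rankOutside b a i = if does (cluster b ≼? A a) then 0 else rankAt b a i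

  rank-split : ∀ b a i → rankAt b a i ≡ rankOutside b a i + rankInside b a i
  rank-split b a i with does (cluster b ≼? A a)
  ... | true  = refl
  ... | false = sym (ℕ.+-identityʳ _)

  inside-mono : ∀ {b b′} → key b ≡ key b′ → insideShift b ≤ℚ insideShift b′ →
                ∀ a i → rankInside b a i ≤ rankInside b′ a i
  inside-mono {b} {b′} same le a i with cluster b ≼? A a | cluster b′ ≼? A a
  ... | no _     | _         = z≤n
  ... | yes c≼a  | no c′⋠a   = contradiction (subst (_≼ A a) (same-cluster same) c≼a) c′⋠a
  ... | yes c≼a  | yes c′≼a  = rank-mono (I i) (dist-inside-≤ c≼a c′≼a le) (side b a i) (side b′ a i)

  outside-mono : ∀ {b b′} → key b ≡ key b′ → δ (B b) ≤ℚ δ (B b′) →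
                 ∀ a i → rankOutside b a i ≤ rankOutside b′ a i
  outside-mono {b} {b′} same le a i with cluster b ≼? A a | cluster b′ ≼? A a
  ... | yes _    | _         = z≤n
  ... | no c⋠a   | yes c′≼a  = contradiction (subst (_≼ A a) (sym (same-cluster same)) c′≼a) c⋠a
  ... | no c⋠a   | no _      = rank-mono (I i) (dist-outside-≤ same c⋠a le) (side b a i) (side b′ a i)

  insideRank outsideRank : Fin k → ℕ
  insideRank  b = ∑ λ a → ∑ (rankInside b a)
  outsideRank b = ∑ λ a → ∑ (rankOutside b a)

  rankTotal : ℕ
  rankTotal = m * (ℓ * 2)

  insideRank≤ : ∀ b → insideRank b ≤ rankTotal
  insideRank≤ b = ∑-≤ λ a → ∑-≤ λ i →
    ℕ.≤-trans (ℕ.≤-trans (ℕ.m≤n+m _ _) (ℕ.≤-reflexive (sym (rank-split b a i)))) (rank≤2 (I i) (side b a i))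

  outsideRank≤ : ∀ b → outsideRank b ≤ rankTotal
  outsideRank≤ b = ∑-≤ λ a → ∑-≤ λ i →
    ℕ.≤-trans (ℕ.≤-trans (ℕ.m≤m+n _ _) (ℕ.≤-reflexive (sym (rank-split b a i)))) (rank≤2 (I i) (side b a i))

  ranks-agree : ∀ {b b′} → key b ≡ key b′ → outsideRank b ≡ outsideRank b′ → insideRank b ≡ insideRank b′ →
                ∀ a i → rankAt b a i ≡ rankAt b′ a i
  ranks-agree {b} {b′} same out≡ in≡ a i = begin
    rankAt b a i                           ≡⟨ rank-split b a i ⟩
    rankOutside b a i + rankInside b a i   ≡⟨ cong₂ _+_ (∑∑-rigid outside-comparable out≡ a i)
                                                         (∑∑-rigid inside-comparable in≡ a i) ⟩
    rankOutside b′ a i + rankInside b′ a i ≡⟨ rank-split b′ a i ⟨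
    rankAt b′ a i                          ∎
    where
      open ≡-Reasoning
      outside-comparable : (∀ a i → rankOutside b a i ≤ rankOutside b′ a i) ⊎
                           (∀ a i → rankOutside b′ a i ≤ rankOutside b a i)
      outside-comparable = Sum.map (outside-mono same) (outside-mono (sym same)) (ℚ.≤-total (δ (B b)) (δ (B b′)))
      inside-comparable : (∀ a i → rankInside b a i ≤ rankInside b′ a i) ⊎
                          (∀ a i → rankInside b′ a i ≤ rankInside b a i)
      inside-comparable = Sum.map (inside-mono same) (inside-mono (sym same)) (ℚ.≤-total (insideShift b) (insideShift b′))

  S-⊆ : ∀ {b b′} → key b ≡ key b′ → outsideRank b ≡ outsideRank b′ → insideRank b ≡ insideRank b′ →
        S b ⊆ S b′
  S-⊆ {b} {b′} same out≡ in≡ {a} a∈ with Equivalence.to (S-realised b a) a∈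
  ... | i , mem = Equivalence.from (S-realised b′ a)
        (i , rank≡1⇒mem (I i) (side b′ a i)
               (trans (sym (ranks-agree same out≡ in≡ a i)) (mem⇒rank≡1 (I i) (side b a i) mem)))

  signature : Fin k → Fin ((m + m) * suc rankTotal * suc rankTotal)
  signature b = combine (combine (join m m (key b)) (fromℕ< (s≤s (outsideRank≤ b)))) (fromℕ< (s≤s (insideRank≤ b)))

  signature-injective : Injective _≡_ _≡_ signature
  signature-injective {b} {b′} eq with Fin.combine-injective _ _ _ _ eq
  ... | eq₁ , in-eq with Fin.combine-injective _ _ _ _ eq₁
  ...   | key-eq , out-eq = S-injective b b′ (⊆-antisym (S-⊆ same out≡ in≡) (S-⊆ (sym same) (sym out≡) (sym in≡)))
    where
      same : key b ≡ key b′
      same = trans (sym (Fin.splitAt-join m m (key b))) (trans (cong (splitAt m) key-eq) (Fin.splitAt-join m m (key b′)))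
      out≡ : outsideRank b ≡ outsideRank b′
      out≡ = Fin.fromℕ<-injective _ _ _ _ out-eq
      in≡ : insideRank b ≡ insideRank b′
      in≡ = Fin.fromℕ<-injective _ _ _ _ in-eq

  size≤ : k ≤ (m + m) * suc rankTotal * suc rankTotal
  size≤ = Fin.injective⇒≤ signature-injective

¬¬-∀-Fin : ∀ {n} {P : Fin n → Set} → (∀ i → ¬ ¬ P i) → ¬ ¬ (∀ i → P i)
¬¬-∀-Fin {zero}  _   k = k λ ()
¬¬-∀-Fin {suc n} ¬¬P k =
  ¬¬P zero λ p₀ → ¬¬-∀-Fin (¬¬P ∘ suc) λ ps → k λ { zero → p₀ ; (suc i) → ps i }

module _ {ℓ} {V : Set} {E : V → V → Set} (pcg : IntervalPCG ℓ E) where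

  open IntervalPCG pcg

  another-vertex : (v : V) → ∃ λ u → u ≢ v
  another-vertex v with ζ-leaf v
  ... | y , e , _ with Rooted.leaf-other-than-root T (ζ v) {y} (λ y≡r → WTree.adj-irr T (subst (WTree.Adj T (ζ v)) y≡r e))
  ...   | x , x-leaf , x≢r with ζ-surj x x-leaf
  ...     | u , ζu≡x = u , λ u≡v → x≢r (trans (sym ζu≡x) (cong ζ u≡v))

empty-ground-set⇒k≡0 : ∀ {k ℓ} {S : Fin k → Subset 0} →
                       (∀ i j → S i ≡ S j → i ≡ j) → IntervalPCG ℓ (IncEdge S) → k ≡ 0
empty-ground-set⇒k≡0 {zero}        _           _   = refl
empty-ground-set⇒k≡0 {suc zero}    _           pcg with another-vertex pcg (inj₂ zero)
... | inj₂ zero , u≢v = contradiction refl u≢v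
empty-ground-set⇒k≡0 {suc (suc k)} {S = S} S-injective _ with S zero | S (suc zero) | S-injective zero (suc zero)
... | [] | [] | same with () ← same refl

module _ {m k ℓ : ℕ} {S : Fin k → Subset m} (pcg : IntervalPCG ℓ (IncEdge S)) where

  open IntervalPCG pcg
  open Data.Nat using (_+_)

  incidences-realised : ∀ r b a → a ∈ˢ S b ⇔
                        ∃ λ i → Interval.mem (I i)
                                  (treeDist (Rooted._∧_ T r) (Rooted.depth T r) (ζ (inj₂ b)) (ζ (inj₁ a)))
  incidences-realised r b a = mk⇔ to from
    where
      open Rooted T r
      Realised : Set
      Realised = ∃ λ i → Interval.mem (I i) (treeDist _∧_ depth (ζ (inj₂ b)) (ζ (inj₁ a)))
      to : a ∈ˢ S b → Realised
      to a∈ with Equivalence.to (edges (inj₂ b) (inj₁ a) λ ()) a∈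
      ... | p , path , i , mem = i , subst (Interval.mem (I i)) (path-weight p path) mem
      from : Realised → a ∈ˢ S b
      from (i , mem) with Trees.toPath T (WTree.connected T (ζ (inj₂ b)) (ζ (inj₁ a)))
      ... | p , path = Equivalence.from (edges (inj₂ b) (inj₁ a) λ ())
                         (p , path , i , subst (Interval.mem (I i)) (sym (path-weight p path)) mem)

  -- Membership of a rational in an interval is not decidable, but the conclusion is a decidable
  -- statement about ℕ, so we may choose, for all b, a and i, the side of I i on which the distance lies.
  ¬¬size≤ : (∀ i j → S i ≡ S j → i ≡ j) → Fin m → ¬ ¬ (k ≤ (m + m) * suc (m * (ℓ * 2)) * suc (m * (ℓ * 2)))
  ¬¬size≤ S-injective a₀ =
    ¬¬-map (TreeRealisation.size≤ isTreeOrder depth (ζ ∘ inj₁) a₀ (ζ ∘ inj₂) I S S-injective (incidences-realised r))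
           (¬¬-∀-Fin λ b → ¬¬-∀-Fin λ a → ¬¬-∀-Fin λ i → ¬¬side (I i))
    where
      r : Fin t
      r = ζ (inj₁ a₀)
      open Rooted T r

size-bound≤cubic : ∀ m ℓ → 1 ≤ m → 1 ≤ ℓ →
                   (m ℕ.+ m) * suc (m * (ℓ * 2)) * suc (m * (ℓ * 2)) ≤ 18 * m ^ 3 * ℓ ^ 2
size-bound≤cubic m ℓ 1≤m 1≤ℓ = begin
  (m + m) * suc (m * (ℓ * 2)) * suc (m * (ℓ * 2)) ≤⟨ ℕ.*-mono-≤ (ℕ.*-monoʳ-≤ (m + m) suc≤3mℓ) suc≤3mℓ ⟩
  (m + m) * (3 * (m * ℓ)) * (3 * (m * ℓ))         ≡⟨ expand m ℓ ⟩
  18 * m ^ 3 * ℓ ^ 2                              ∎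
  where
    open ℕ.≤-Reasoning
    open +-*-Solver
    open Data.Nat using (_+_)
    expand : ∀ m ℓ → (m + m) * (3 * (m * ℓ)) * (3 * (m * ℓ)) ≡ 18 * m ^ 3 * ℓ ^ 2
    expand = solve 2 (λ m l → (m :+ m) :* (con 3 :* (m :* l)) :* (con 3 :* (m :* l)) := con 18 :* m :^ 3 :* l :^ 2) refl
    suc≤3mℓ : suc (m * (ℓ * 2)) ≤ 3 * (m * ℓ)
    suc≤3mℓ = begin
      suc (m * (ℓ * 2))   ≡⟨ solve 2 (λ m l → con 1 :+ m :* (l :* con 2) := con 1 :+ con 2 :* (m :* l)) refl m ℓ ⟩
      1 + 2 * (m * ℓ)     ≤⟨ ℕ.+-monoˡ-≤ (2 * (m * ℓ)) (ℕ.*-mono-≤ 1≤m 1≤ℓ) ⟩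
      m * ℓ + 2 * (m * ℓ) ≡⟨ solve 1 (λ x → x :+ con 2 :* x := con 3 :* x) refl (m * ℓ) ⟩
      3 * (m * ℓ)         ∎

proposition22 : Σ ℕ λ C → 0 < C ×
    ((m k ℓ : ℕ) → 1 ≤ ℓ → (S : Fin k → Subset m) →
      (∀ i j → S i ≡ S j → i ≡ j) →
      IntervalPCG ℓ (IncEdge S) →
      k ≤ C * m ^ 3 * ℓ ^ 2)
proposition22 = 18 , s≤s z≤n , λ where
  zero    k ℓ _   S S-injective pcg → ℕ.≤-reflexive (empty-ground-set⇒k≡0 S-injective pcg)
  (suc m) k ℓ 1≤ℓ S S-injective pcg →
    ℕ.≤-trans (decidable-stable (k ≤? _) (¬¬size≤ pcg S-injective zero))
              (size-bound≤cubic (suc m) ℓ (s≤s z≤n) 1≤ℓ)
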